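{- Let $k$ be a positive integer. As a function of $n\geq 3$, $\chi_L(S_n(k))$ is increasing, in the sense that $\chi_L(S_{n-1}(k))\leq\chi_L(S_n(k))$ for all $n\geq 3$, and unbounded.
   Context: For a simple connected graph $G=(V,E)$, a $k$-coloring is a map $c:V\to\{1,\dots,k\}$ with adjacent vertices receiving different colors; $c^{ -1}(i)$ denotes the $i$-th color class, and $d(u,S)=\min_{v\in S}d(u,v)$. The color code of $v$ is $r_c(v)=(d(v,c^{ -1}(1)),\dots,d(v,c^{ -1}(k)))$. The coloring $c$ is a locating coloring if distinct vertices have distinct color codes. The locating chromatic number $\chi_L(G)$ is the least $k$ such that $G$ has a locating $k$-coloring. $S_n(k)$ denotes the tree consisting of $n$ paths of length $k$ sharing one common endpoint (the hub), otherwise disjoint. -}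

module Defs where

open import Data.Nat using (ℕ; zero; suc; _≤_; _<_)
open import Data.Fin using (Fin; toℕ)
open import Data.Maybe using (Maybe; just; nothing)
open import Data.Product using (_×_; Σ; ∃; _,_)
open import Relation.Binary.PropositionalEquality using (_≡_; _≢_)
open import Relation.Nullary using (¬_)
open import Function.Bundles using (_⇔_)

record Graph : Set₁ where
  field
    V   : Set
    Adj : V → V → Set

module _ (G : Graph) where
  open Graph G

  data Walk : V → V → ℕ → Set where
    nil  : ∀ {u} → Walk u u 0
    cons : ∀ {u v w l} → Adj u v → Walk v w l → Walk u w (suc l)

  Dist : V → V → ℕ → Set
  Dist u v d = Walk u v d × (∀ l → Walk u v l → d ≤ l)

  record Coloring (k : ℕ) : Set where
    field
      col    : V → Fin k
      proper : ∀ {u v} → Adj u v → col u ≢ col v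

  DistToClass : ∀ {k} → Coloring k → V → Fin k → ℕ → Set
  DistToClass c u i d =
    (Σ V λ v → Coloring.col c v ≡ i × Dist u v d) ×
    (∀ v d' → Coloring.col c v ≡ i → Dist u v d' → d ≤ d')

  SameCode : ∀ {k} → Coloring k → V → V → Set
  SameCode {k} c u v = ∀ (i : Fin k) (d : ℕ) → DistToClass c u i d ⇔ DistToClass c v i d

  IsLocating : ∀ {k} → Coloring k → Set
  IsLocating c = ∀ u v → SameCode c u v → u ≡ v

  HasLocatingColoring : ℕ → Set
  HasLocatingColoring k = Σ (Coloring k) IsLocating

  IsLocChromNum : ℕ → Set
  IsLocChromNum m = HasLocatingColoring m × (∀ j → j < m → ¬ HasLocatingColoring j)

-- S_n(k): hub = nothing; just (i , j) is the vertex at distance j+1 from the hub on path i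
data SAdj (n k : ℕ) : Maybe (Fin n × Fin k) → Maybe (Fin n × Fin k) → Set where
  hub-out : ∀ {i a} → toℕ a ≡ 0 → SAdj n k nothing (just (i , a))
  hub-in  : ∀ {i a} → toℕ a ≡ 0 → SAdj n k (just (i , a)) nothing
  step-up : ∀ {i a b} → toℕ b ≡ suc (toℕ a) → SAdj n k (just (i , a)) (just (i , b))
  step-dn : ∀ {i a b} → toℕ a ≡ suc (toℕ b) → SAdj n k (just (i , a)) (just (i , b))

S : ℕ → ℕ → Graph
S n k = record { V = Maybe (Fin n × Fin k) ; Adj = SAdj n k }

module Submission where

-- Take a locating colouring of S_{n+1}(k) with b colours. If some leg L is such that
-- every vertex on it shares its colour with the hub or with a vertex no deeper on another leg, then
-- deleting L changes no distance from a remaining vertex to a colour class, so S_n(k) has a locating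
-- b-colouring. Otherwise every leg L owns a colour occurring on L at a depth where it occurs on no
-- other leg at that depth or above; distinct legs own distinct colours, so b ≥ n + 1, while the parity
-- colouring below shows χ_L(S_n(k)) ≤ n + 1.
-- Unboundedness. The n neighbours of the hub are adjacent to it, so each coordinate of their colour
-- codes lies within 1 of the hub's; a locating b-colouring thus separates at most 3^b of them. The
-- least b exists because having a locating b-colouring is decidable for a finite graph.

open import Defs
open import Data.Bool using (Bool; true; false; not; if_then_else_)
open import Data.Empty using (⊥-elim)
open import Data.Fin as Fin using (Fin; toℕ; fromℕ<; punchIn; punchOut; funToFin; finToFun)
import Data.Fin.Properties as Finₚ
open import Data.Maybe using (Maybe; just; nothing)
import Data.Maybe.Properties as Maybeₚ
open import Data.Nat
  using (ℕ; zero; suc; _+_; _∸_; _⊔_; _^_; _≤_; _<_; z≤n; s≤s; s≤s⁻¹; ∣_-_∣; _≟_; _≤?_)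
open import Data.Nat.DivMod using (_mod_; m<n⇒m%n≡m)
open import Data.Nat.Properties
open import Data.Product using (_×_; Σ; ∃; ∃₂; _,_; proj₁; proj₂)
import Data.Product.Properties as Productₚ
open import Data.Sum using (_⊎_; inj₁; inj₂; [_,_]′)
open import Function.Base using (_∘_)
open import Function.Bundles using (mk⇔; Equivalence)
import Function.Properties.Equivalence as ⇔
open import Relation.Nullary using (¬_; Dec; yes; no; contradiction)
open import Relation.Nullary.Decidable using (map′; _×-dec_; _⊎-dec_; _→-dec_; ¬?)
open import Relation.Unary using (Decidable)
open import Relation.Binary.PropositionalEquality

module _ {G : Graph} where
  open Graph G

  walk-++ : ∀ {u v w l m} → Walk G u v l → Walk G v w m → Walk G u w (l + m)
  walk-++ nil q = q
  walk-++ (cons e p) q = cons e (walk-++ p q)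

  walk-reverse : (∀ {x y} → Adj x y → Adj y x) → ∀ {u v l} → Walk G u v l → Walk G v u l
  walk-reverse adj-sym nil = nil
  walk-reverse adj-sym (cons {l = l} e p) =
    subst (Walk G _ _) (+-comm l 1) (walk-++ (walk-reverse adj-sym p) (cons (adj-sym e) nil))

  walk-lipschitz : (f : V → ℕ) → (∀ {x y} → Adj x y → f y ≤ suc (f x)) →
                   ∀ {u v l} → Walk G u v l → f v ≤ f u + l
  walk-lipschitz f step {u} nil = ≤-reflexive (sym (+-identityʳ (f u)))
  walk-lipschitz f step {u} (cons {v = v} {w} {l} e p) = begin
    f w           ≤⟨ walk-lipschitz f step p ⟩
    f v + l       ≤⟨ +-monoˡ-≤ l (step e) ⟩
    suc (f u) + l ≡⟨ +-suc (f u) l ⟨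
    f u + suc l   ∎
    where open ≤-Reasoning

  IsLocating-resp-≗ : ∀ {b} (c c′ : Coloring G b) → (∀ v → Coloring.col c v ≡ Coloring.col c′ v) →
                      IsLocating G c → IsLocating G c′
  IsLocating-resp-≗ c c′ c≗c′ loc u v same = loc u v λ x d → mk⇔
    (transport c′ c (sym ∘ c≗c′) ∘ Equivalence.to (same x d) ∘ transport c c′ c≗c′)
    (transport c′ c (sym ∘ c≗c′) ∘ Equivalence.from (same x d) ∘ transport c c′ c≗c′)
    where
    transport : ∀ {b} (c c′ : Coloring G b) → (∀ v → Coloring.col c v ≡ Coloring.col c′ v) →
                ∀ {u x d} → DistToClass G c u x d → DistToClass G c′ u x d
    transport c c′ c≗c′ ((v , cv , duv) , least) =
      (v , trans (sym (c≗c′ v)) cv , duv) , λ w d′ cw → least w d′ (trans (c≗c′ w) cw)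

  IsLocChromNum⇒≤ : ∀ {a j} → IsLocChromNum G a → HasLocatingColoring G j → a ≤ j
  IsLocChromNum⇒≤ (_ , minimal) h = ≮⇒≥ (λ j<a → minimal _ j<a h)

least-witness : {P : ℕ → Set} → Decidable P → ∀ {N} → P N → ∃ λ d → P d × (∀ d′ → d′ < d → ¬ P d′)
least-witness {P} P? {N} pN with search (suc N)
  where
  search : ∀ M → (∃ λ d → P d × (∀ d′ → d′ < d → ¬ P d′)) ⊎ (∀ d′ → d′ < M → ¬ P d′)
  search zero = inj₂ λ _ ()
  search (suc M) with search M
  ... | inj₁ found = inj₁ found
  ... | inj₂ none with P? M
  ...   | yes pM = inj₁ (M , pM , none)
  ...   | no ¬pM = inj₂ λ d d<1+M →
          [ none d , (λ { refl → ¬pM }) ]′ (m≤n⇒m<n∨m≡n (s≤s⁻¹ d<1+M))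
... | inj₁ found = found
... | inj₂ none = ⊥-elim (none N ≤-refl pN)

∣n-1+n∣≡1 : ∀ x → ∣ x - suc x ∣ ≡ 1
∣n-1+n∣≡1 zero = refl
∣n-1+n∣≡1 (suc x) = ∣n-1+n∣≡1 x

∣-∣-step : ∀ x y z → ∣ y - z ∣ ≡ 1 → ∣ x - z ∣ ≤ suc ∣ x - y ∣
∣-∣-step x y z ∣y-z∣≡1 = begin
  ∣ x - z ∣             ≤⟨ ∣-∣-triangle x y z ⟩
  ∣ x - y ∣ + ∣ y - z ∣ ≡⟨ cong (∣ x - y ∣ +_) ∣y-z∣≡1 ⟩
  ∣ x - y ∣ + 1         ≡⟨ +-comm _ 1 ⟩
  suc ∣ x - y ∣         ∎
  where open ≤-Reasoning

offset : ℕ → ℕ → Fin 3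
offset e d = (suc d ∸ e) mod 3

toℕ-offset : ∀ {e d} → d ≤ suc e → toℕ (offset e d) ≡ suc d ∸ e
toℕ-offset {e} {d} d≤1+e = trans (Finₚ.toℕ-fromℕ< _) (m<n⇒m%n≡m (s≤s suc-d∸e≤2))
  where
  suc-d∸e≤2 : suc d ∸ e ≤ 2
  suc-d∸e≤2 = ≤-trans (∸-monoˡ-≤ e (s≤s d≤1+e)) (≤-reflexive (m+n∸n≡m 2 e))

offset-injective : ∀ {e d d′} → d ≤ suc e → e ≤ suc d → d′ ≤ suc e → e ≤ suc d′ →
                   offset e d ≡ offset e d′ → d ≡ d′
offset-injective {e} {d} {d′} d≤1+e e≤1+d d′≤1+e e≤1+d′ eq = suc-injective (begin
  suc d          ≡⟨ m∸n+n≡m e≤1+d ⟨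
  suc d ∸ e + e  ≡⟨ cong (_+ e) (trans (sym (toℕ-offset d≤1+e)) (trans (cong toℕ eq) (toℕ-offset d′≤1+e))) ⟩
  suc d′ ∸ e + e ≡⟨ m∸n+n≡m e≤1+d′ ⟩
  suc d′         ∎)
  where open ≡-Reasoning

offsetCode : Maybe ℕ → Maybe ℕ → Fin 3
offsetCode (just e) (just d) = offset e d
offsetCode _ _ = Fin.zero

module Spider (n k : ℕ) where

  Vertex : Set
  Vertex = Maybe (Fin n × Fin k)

  adj-sym : ∀ {u v} → SAdj n k u v → SAdj n k v u
  adj-sym (hub-out e) = hub-in e
  adj-sym (hub-in e) = hub-out e
  adj-sym (step-up e) = step-dn e
  adj-sym (step-dn e) = step-up e

  adj? : (u v : Vertex) → Dec (SAdj n k u v)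
  adj? nothing nothing = no λ ()
  adj? nothing (just (i , a)) = map′ hub-out (λ { (hub-out e) → e }) (toℕ a ≟ 0)
  adj? (just (i , a)) nothing = map′ hub-in (λ { (hub-in e) → e }) (toℕ a ≟ 0)
  adj? (just (i , a)) (just (j , b)) with i Fin.≟ j
  ... | no i≢j = no λ { (step-up _) → i≢j refl ; (step-dn _) → i≢j refl }
  ... | yes refl = map′ [ step-up , step-dn ]′ (λ { (step-up e) → inj₁ e ; (step-dn e) → inj₂ e })
                        ((toℕ b ≟ suc (toℕ a)) ⊎-dec (toℕ a ≟ suc (toℕ b)))

  legDist : {i j : Fin n} → Dec (i ≡ j) → ℕ → ℕ → ℕ
  legDist (yes _) a b = ∣ a - b ∣
  legDist (no _) a b = suc a + suc b

  dist : Vertex → Vertex → ℕ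
  dist nothing nothing = 0
  dist nothing (just (j , b)) = suc (toℕ b)
  dist (just (i , a)) nothing = suc (toℕ a)
  dist (just (i , a)) (just (j , b)) = legDist (i Fin.≟ j) (toℕ a) (toℕ b)

  depth : Vertex → ℕ
  depth u = dist u nothing

  dist-refl : ∀ u → dist u u ≡ 0
  dist-refl nothing = refl
  dist-refl (just (i , a)) with i Fin.≟ i
  ... | yes _ = ∣n-n∣≡0 (toℕ a)
  ... | no i≢i = ⊥-elim (i≢i refl)

  dist-sym : ∀ u v → dist u v ≡ dist v u
  dist-sym nothing nothing = refl
  dist-sym nothing (just _) = refl
  dist-sym (just _) nothing = refl
  dist-sym (just (i , a)) (just (j , b)) with i Fin.≟ j | j Fin.≟ i
  ... | yes _ | yes _ = ∣-∣-comm (toℕ a) (toℕ b)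
  ... | no _ | no _ = +-comm (suc (toℕ a)) (suc (toℕ b))
  ... | yes i≡j | no j≢i = ⊥-elim (j≢i (sym i≡j))
  ... | no i≢j | yes j≡i = ⊥-elim (i≢j (sym j≡i))

  dist≡0⇒≡ : ∀ u v → dist u v ≡ 0 → u ≡ v
  dist≡0⇒≡ nothing nothing _ = refl
  dist≡0⇒≡ (just (i , a)) (just (j , b)) d≡0 with i Fin.≟ j
  ... | yes refl = cong (λ c → just (i , c)) (Finₚ.toℕ-injective (∣m-n∣≡0⇒m≡n d≡0))

  dist-via-hub : ∀ u j (b : Fin k) → dist u (just (j , b)) ≤ depth u + suc (toℕ b)
  dist-via-hub nothing j b = ≤-refl
  dist-via-hub (just (i , a)) j b with i Fin.≟ j
  ... | no _ = ≤-refl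
  ... | yes _ = begin
    ∣ toℕ a - toℕ b ∣            ≤⟨ ∣m-n∣≤m⊔n (toℕ a) (toℕ b) ⟩
    toℕ a ⊔ toℕ b                ≤⟨ m⊔n≤m+n (toℕ a) (toℕ b) ⟩
    toℕ a + toℕ b                ≤⟨ m≤n+m _ 1 ⟩
    suc (toℕ a + toℕ b)          ≤⟨ s≤s (+-monoʳ-≤ (toℕ a) (n≤1+n _)) ⟩
    suc (toℕ a) + suc (toℕ b)    ∎
    where open ≤-Reasoning

  dist-step : ∀ w {u v} → SAdj n k u v → dist w v ≤ suc (dist w u)
  dist-step nothing (hub-out a≡0) rewrite a≡0 = ≤-refl
  dist-step nothing (hub-in _) = z≤n
  dist-step nothing (step-up b≡1+a) rewrite b≡1+a = ≤-refl
  dist-step nothing (step-dn a≡1+b) rewrite a≡1+b = ≤-trans (n≤1+n _) (n≤1+n _)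
  dist-step (just (i , a)) (hub-out {i = j} b≡0) with i Fin.≟ j
  ... | yes _ rewrite b≡0 = ≤-trans (≤-reflexive (∣-∣-identityʳ (toℕ a))) (≤-trans (n≤1+n _) (n≤1+n _))
  ... | no _ rewrite b≡0 = ≤-reflexive (+-comm (suc (toℕ a)) 1)
  dist-step (just (i , a)) (hub-in {i = j} b≡0) with i Fin.≟ j
  ... | yes _ rewrite b≡0 = s≤s (≤-reflexive (sym (∣-∣-identityʳ (toℕ a))))
  ... | no _ = s≤s (≤-trans (m≤m+n (toℕ a) _) (n≤1+n _))
  dist-step (just (i , a)) (step-up {i = j} {b} {c} c≡1+b) with i Fin.≟ j
  ... | yes _ = ∣-∣-step (toℕ a) (toℕ b) (toℕ c) (trans (cong (∣ toℕ b -_∣) c≡1+b) (∣n-1+n∣≡1 (toℕ b)))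
  ... | no _ rewrite c≡1+b = s≤s (≤-reflexive (+-suc (toℕ a) (suc (toℕ b))))
  dist-step (just (i , a)) (step-dn {i = j} {b} {c} b≡1+c) with i Fin.≟ j
  ... | yes _ = ∣-∣-step (toℕ a) (toℕ b) (toℕ c)
                  (trans (cong (∣_- toℕ c ∣) b≡1+c)
                         (trans (∣-∣-comm (suc (toℕ c)) (toℕ c)) (∣n-1+n∣≡1 (toℕ c))))
  ... | no _ rewrite b≡1+c = ≤-trans (+-monoʳ-≤ (suc (toℕ a)) (n≤1+n _)) (n≤1+n _)

  first : 0 < k → Fin k
  first 0<k = fromℕ< 0<k

  toℕ-first : ∀ 0<k → toℕ (first 0<k) ≡ 0
  toℕ-first 0<k = Finₚ.toℕ-fromℕ< 0<k

  descent : ∀ d i (a b : Fin k) → toℕ a ≡ d + toℕ b → Walk (S n k) (just (i , a)) (just (i , b)) d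
  descent zero i a b a≡b rewrite Finₚ.toℕ-injective a≡b = nil
  descent (suc d) i a b a≡1+d+b =
    cons (step-dn (trans a≡1+d+b (cong suc (sym (Finₚ.toℕ-fromℕ< d+b<k)))))
         (descent d i (fromℕ< d+b<k) b (Finₚ.toℕ-fromℕ< d+b<k))
    where
    d+b<k : d + toℕ b < k
    d+b<k = ≤-trans (≤-reflexive (sym a≡1+d+b)) (≤-trans (n≤1+n _) (Finₚ.toℕ<n a))

  walk-to-hub : ∀ i (a : Fin k) → Walk (S n k) (just (i , a)) nothing (suc (toℕ a))
  walk-to-hub i a = subst (Walk (S n k) _ _) (+-comm (toℕ a) 1)
    (walk-++ (descent (toℕ a) i a (first 0<k) (sym (trans (cong (toℕ a +_) (toℕ-first 0<k)) (+-identityʳ _))))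
             (cons (hub-in (toℕ-first 0<k)) nil))
    where
    0<k : 0 < k
    0<k = ≤-trans (s≤s z≤n) (Finₚ.toℕ<n a)

  geodesic : ∀ u v → Walk (S n k) u v (dist u v)
  geodesic nothing nothing = nil
  geodesic nothing (just (j , b)) = walk-reverse adj-sym (walk-to-hub j b)
  geodesic (just (i , a)) nothing = walk-to-hub i a
  geodesic (just (i , a)) (just (j , b)) with i Fin.≟ j
  ... | no _ = walk-++ (walk-to-hub i a) (walk-reverse adj-sym (walk-to-hub j b))
  ... | yes refl with toℕ b ≤? toℕ a
  ...   | yes b≤a = subst (Walk (S n k) _ _) (sym (m≤n⇒∣n-m∣≡n∸m b≤a))
                      (descent (toℕ a ∸ toℕ b) i a b (sym (m∸n+n≡m b≤a)))
  ...   | no b≰a = subst (Walk (S n k) _ _) (trans (sym (m≤n⇒∣n-m∣≡n∸m a≤b)) (∣-∣-comm (toℕ b) (toℕ a)))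
                      (walk-reverse adj-sym (descent (toℕ b ∸ toℕ a) i b a (sym (m∸n+n≡m a≤b))))
    where
    a≤b : toℕ a ≤ toℕ b
    a≤b = <⇒≤ (≰⇒> b≰a)

  dist≤walk : ∀ {u v l} → Walk (S n k) u v l → dist u v ≤ l
  dist≤walk {u} {v} {l} w = subst (λ d → dist u v ≤ d + l) (dist-refl u) (walk-lipschitz (dist u) (dist-step u) w)

  Dist⇒dist : ∀ {u v d} → Dist (S n k) u v d → dist u v ≡ d
  Dist⇒dist {u} {v} (w , shortest) = ≤-antisym (dist≤walk w) (shortest _ (geodesic u v))

  dist-Dist : ∀ u v → Dist (S n k) u v (dist u v)
  dist-Dist u v = geodesic u v , λ l w → dist≤walk w

  ∃-vertex? : {P : Vertex → Set} → Decidable P → Dec (∃ P)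
  ∃-vertex? {P} P? = map′ [ (nothing ,_) , (λ (i , a , p) → just (i , a) , p) ]′ split
    (P? nothing ⊎-dec Finₚ.any? λ i → Finₚ.any? λ a → P? (just (i , a)))
    where
    split : ∃ P → P nothing ⊎ ∃₂ λ i a → P (just (i , a))
    split (nothing , p) = inj₁ p
    split (just (i , a) , p) = inj₂ (i , a , p)

  ∀-vertex? : {P : Vertex → Set} → Decidable P → Dec (∀ v → P v)
  ∀-vertex? {P} P? = map′ join (λ all → all nothing , λ i a → all (just (i , a)))
    (P? nothing ×-dec Finₚ.all? λ i → Finₚ.all? λ a → P? (just (i , a)))
    where
    join : P nothing × (∀ i a → P (just (i , a))) → ∀ v → P v
    join (p , _) nothing = p
    join (_ , q) (just (i , a)) = q i a

  ≢⇒0<dist : ∀ u v → u ≢ v → 0 < dist u v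
  ≢⇒0<dist u v u≢v with dist u v in eq
  ... | zero = ⊥-elim (u≢v (dist≡0⇒≡ u v eq))
  ... | suc _ = s≤s z≤n

  _≟ᵥ_ : (u v : Vertex) → Dec (u ≡ v)
  _≟ᵥ_ = Maybeₚ.≡-dec (Productₚ.≡-dec Fin._≟_ Fin._≟_)

  module _ {b} (c : Coloring (S n k) b) where
    open Coloring c

    ClassDist : Vertex → Fin b → ℕ → Set
    ClassDist u x d = (∃ λ v → col v ≡ x × dist u v ≡ d) × (∀ v → col v ≡ x → d ≤ dist u v)

    DistToClass⇒ClassDist : ∀ {u x d} → DistToClass (S n k) c u x d → ClassDist u x d
    DistToClass⇒ClassDist {u} ((v , cv , duv) , least) =
      (v , cv , Dist⇒dist duv) , λ w cw → least w (dist u w) cw (dist-Dist u w)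

    ClassDist⇒DistToClass : ∀ {u x d} → ClassDist u x d → DistToClass (S n k) c u x d
    ClassDist⇒DistToClass {u} {d = d} ((v , cv , duv) , least) =
      (v , cv , subst (Dist (S n k) u v) duv (dist-Dist u v)) ,
      λ w d′ cw Duw → subst (d ≤_) (Dist⇒dist Duw) (least w cw)

    ClassDist-unique : ∀ {u x d e} → ClassDist u x d → ClassDist u x e → d ≡ e
    ClassDist-unique ((v , cv , duv) , least) ((w , cw , duw) , least′) =
      ≤-antisym (subst (_ ≤_) duw (least w cw)) (subst (_ ≤_) duv (least′ v cv))

    ClassDist-own : ∀ u → ClassDist u (col u) 0
    ClassDist-own u = (u , refl , dist-refl u) , λ _ _ → z≤n

    ClassDist-adj : ∀ {u v x d e} → SAdj n k u v → ClassDist u x d → ClassDist v x e → d ≤ suc e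
    ClassDist-adj {u} {v} u~v (_ , least) ((w , cw , dvw) , _) = begin
      _                ≤⟨ least w cw ⟩
      dist u w         ≡⟨ dist-sym u w ⟩
      dist w u         ≤⟨ dist-step w (adj-sym u~v) ⟩
      suc (dist w v)   ≡⟨ cong suc (trans (dist-sym w v) dvw) ⟩
      suc _            ∎
      where open ≤-Reasoning

    SameCode⇒ClassDist : ∀ {u v} → SameCode (S n k) c u v → ∀ {x d} → ClassDist u x d → ClassDist v x d
    SameCode⇒ClassDist {u} {v} same {x} {d} =
      DistToClass⇒ClassDist {v} ∘ Equivalence.to (same x d) ∘ ClassDist⇒DistToClass {u}

    SameCode⇒ClassDist≡ : ∀ {u v x d e} → SameCode (S n k) c u v → ClassDist u x d → ClassDist v x e → d ≡ e
    SameCode⇒ClassDist≡ {v = v} same D = ClassDist-unique {v} (SameCode⇒ClassDist same D)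

    SameCode-sym : ∀ {u v} → SameCode (S n k) c u v → SameCode (S n k) c v u
    SameCode-sym same x d = ⇔.sym (same x d)

    Used : Fin b → Set
    Used x = ∃ λ w → col w ≡ x

    used? : Decidable Used
    used? x = ∃-vertex? λ w → col w Fin.≟ x

    classDist : ∀ {x} → Used x → ∀ u → ∃ (ClassDist u x)
    classDist {x} (w , cw) u with least-witness (λ d → ∃-vertex? λ v → (col v Fin.≟ x) ×-dec (dist u v ≟ d))
                                              {dist u w} (w , cw , refl)
    ... | d , attained , minimal = d , attained , λ v cv → ≮⇒≥ λ d′<d → minimal _ d′<d (v , cv , refl)

    -- The x-th coordinate of r_c(u), or nothing if colour x is unused (then no DistToClass holds).
    code : Vertex → Fin b → Maybe ℕ
    code u x with used? x
    ... | yes w = just (proj₁ (classDist w u))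
    ... | no _ = nothing

    ClassDist⇒code : ∀ {u x d} → ClassDist u x d → code u x ≡ just d
    ClassDist⇒code {u} {x} D@((v , cv , _) , _) with used? x
    ... | yes w = cong just (ClassDist-unique {u} (proj₂ (classDist w u)) D)
    ... | no unused = ⊥-elim (unused (v , cv))

    code⇒ClassDist : ∀ {u x d} → code u x ≡ just d → ClassDist u x d
    code⇒ClassDist {u} {x} code≡d with used? x
    code⇒ClassDist {u} {x} refl | yes w = proj₂ (classDist w u)

    code-unused : ∀ {x} → ¬ Used x → ∀ u → code u x ≡ nothing
    code-unused {x} unused u with used? x
    ... | yes w = ⊥-elim (unused w)
    ... | no _ = refl

    classDist≡⇒code≡ : ∀ {u v} x → Dec (Used x) →
                    (∀ (w : Used x) → proj₁ (classDist w u) ≡ proj₁ (classDist w v)) → code u x ≡ code v x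
    classDist≡⇒code≡ {u} {v} x (yes w) same-dist =
      trans (ClassDist⇒code (proj₂ (classDist w u)))
            (trans (cong just (same-dist w)) (sym (ClassDist⇒code (proj₂ (classDist w v)))))
    classDist≡⇒code≡ {u} {v} x (no unused) _ = trans (code-unused unused u) (sym (code-unused unused v))

    SameCode⇒code : ∀ {u v} → SameCode (S n k) c u v → ∀ x → code u x ≡ code v x
    SameCode⇒code {u} {v} same x = classDist≡⇒code≡ x (used? x) λ w →
      SameCode⇒ClassDist≡ same (proj₂ (classDist w u)) (proj₂ (classDist w v))

    code⇒SameCode : ∀ {u v} → (∀ x → code u x ≡ code v x) → SameCode (S n k) c u v
    code⇒SameCode {u} {v} same x d = mk⇔
      (ClassDist⇒DistToClass {v} ∘ code⇒ClassDist ∘ trans (sym (same x)) ∘ ClassDist⇒code ∘ DistToClass⇒ClassDist {u})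
      (ClassDist⇒DistToClass {u} ∘ code⇒ClassDist ∘ trans (same x) ∘ ClassDist⇒code ∘ DistToClass⇒ClassDist {v})

    isLocating? : Dec (IsLocating (S n k) c)
    isLocating? = ∀-vertex? λ u → ∀-vertex? λ v →
      map′ code⇒SameCode SameCode⇒code (Finₚ.all? λ x → Maybeₚ.≡-dec _≟_ (code u x) (code v x))
        →-dec (u ≟ᵥ v)

  module _ {j : ℕ} where

    Proper : (Vertex → Fin j) → Set
    Proper f = ∀ u v → SAdj n k u v → f u ≢ f v

    proper? : Decidable Proper
    proper? f = ∀-vertex? λ u → ∀-vertex? λ v → adj? u v →-dec ¬? (f u Fin.≟ f v)

    colouring : (f : Vertex → Fin j) → Proper f → Coloring (S n k) j
    colouring f proper = record { col = f ; proper = proper _ _ }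

    LocatingMap : (Vertex → Fin j) → Set
    LocatingMap f = Σ (Proper f) λ proper → IsLocating (S n k) (colouring f proper)

    locatingMap? : Decidable LocatingMap
    locatingMap? f with proper? f
    ... | no improper = no (improper ∘ proj₁)
    ... | yes proper = map′ (proper ,_) proj₂ (isLocating? (colouring f proper))

    -- A map Vertex → Fin j is coded by its hub colour and, via funToFin, by its table of leg colours.
    decode : Fin j → Fin ((j ^ k) ^ n) → Vertex → Fin j
    decode h g nothing = h
    decode h g (just (i , a)) = finToFun (finToFun g i) a

    table : (Vertex → Fin j) → Fin ((j ^ k) ^ n)
    table f = funToFin λ i → funToFin λ a → f (just (i , a))

    decode-table : ∀ f v → decode (f nothing) (table f) v ≡ f v
    decode-table f nothing = refl
    decode-table f (just (i , a)) =
      trans (cong (λ t → finToFun t a) (Finₚ.finToFun-funToFin _ i)) (Finₚ.finToFun-funToFin _ a)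

  hasLocatingColoring? : ∀ j → Dec (HasLocatingColoring (S n k) j)
  hasLocatingColoring? j =
    map′ (λ (h , g , proper , loc) → colouring (decode h g) proper , loc) tabulate
         (Finₚ.any? λ h → Finₚ.any? λ g → locatingMap? (decode h g))
    where
    tabulate : HasLocatingColoring (S n k) j → ∃₂ λ h g → LocatingMap (decode h g)
    tabulate (c , loc) = col nothing , table col , proper ,
                         IsLocating-resp-≗ c (colouring f proper) (sym ∘ decode≗col) loc
      where
      open Coloring c using (col)
      f : Vertex → Fin j
      f = decode (col nothing) (table col)
      decode≗col : ∀ v → f v ≡ col v
      decode≗col = decode-table col
      proper : Proper f
      proper u v u~v eq = Coloring.proper c u~v (trans (sym (decode≗col u)) (trans eq (decode≗col v)))

  χL-exists : ∀ {j} → HasLocatingColoring (S n k) j → ∃ (IsLocChromNum (S n k))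
  χL-exists = least-witness hasLocatingColoring?

  -- Each coordinate of a hub neighbour's code is within 1 of the hub's (ClassDist-adj), so it is
  -- determined by its offset in Fin 3; a locating colouring makes these offset profiles distinct.
  legs≤3^colours : 1 ≤ k → ∀ {b} (c : Coloring (S n k) b) → IsLocating (S n k) c → n ≤ 3 ^ b
  legs≤3^colours k≥1 {b} c loc = Finₚ.injective⇒≤ {f = funToFin ∘ profile} λ {i} {j} eq →
    profile-injective i j λ x → trans (sym (Finₚ.finToFun-funToFin (profile i) x))
      (trans (cong (λ t → finToFun t x) eq) (Finₚ.finToFun-funToFin (profile j) x))
    where
    neighbour : Fin n → Vertex
    neighbour i = just (i , first k≥1)

    hub~ : ∀ i → SAdj n k nothing (neighbour i)
    hub~ i = hub-out (toℕ-first k≥1)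

    profile : Fin n → Fin b → Fin 3
    profile i x = offsetCode (code c nothing x) (code c (neighbour i) x)

    distance-offset : ∀ {x} (w : Used c x) i →
      profile i x ≡ offset (proj₁ (classDist c w nothing)) (proj₁ (classDist c w (neighbour i)))
    distance-offset w i = cong₂ offsetCode (ClassDist⇒code c (proj₂ (classDist c w nothing)))
                                          (ClassDist⇒code c (proj₂ (classDist c w (neighbour i))))

    profile-injective : ∀ i j → (∀ x → profile i x ≡ profile j x) → i ≡ j
    profile-injective i j same = cong proj₁ (Maybeₚ.just-injective
      (loc (neighbour i) (neighbour j) (code⇒SameCode c λ x → classDist≡⇒code≡ c x (used? c x) λ w →
        let (e , Dh) = classDist c w nothing
            (dᵢ , Dᵢ) = classDist c w (neighbour i)
            (dⱼ , Dⱼ) = classDist c w (neighbour j)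
        in offset-injective (ClassDist-adj c (adj-sym (hub~ i)) Dᵢ Dh) (ClassDist-adj c (hub~ i) Dh Dᵢ)
                            (ClassDist-adj c (adj-sym (hub~ j)) Dⱼ Dh) (ClassDist-adj c (hub~ j) Dh Dⱼ)
             (trans (sym (distance-offset w i)) (trans (same x) (distance-offset w j))))))

even : ℕ → Bool
even zero = true
even (suc d) = not (even d)

-- Every vertex on leg i is within distance 1 of colour suc i, but at distance ≥ 2 from every other
-- colour suc j, from which the hub is at distance 1.
module ParityColouring (m k : ℕ) (k≥1 : 1 ≤ k) where
  open Spider (suc (suc m)) k

  legColour : Fin (suc (suc m)) → ℕ → Fin (suc (suc (suc m)))
  legColour i d = if even d then Fin.suc i else Fin.zero

  parityColour : Vertex → Fin (suc (suc (suc m)))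
  parityColour nothing = Fin.zero
  parityColour (just (i , a)) = legColour i (toℕ a)

  parity-alternates : ∀ i d → legColour i d ≢ legColour i (suc d)
  parity-alternates i d with even d
  ... | true = λ ()
  ... | false = λ ()

  parityColour-proper : Proper parityColour
  parityColour-proper _ _ (hub-out a≡0) rewrite a≡0 = λ ()
  parityColour-proper _ _ (hub-in a≡0) rewrite a≡0 = λ ()
  parityColour-proper _ _ (step-up {i} {a} b≡1+a) rewrite b≡1+a = parity-alternates i (toℕ a)
  parityColour-proper _ _ (step-dn {i} {b = b} a≡1+b) rewrite a≡1+b = parity-alternates i (toℕ b) ∘ sym

  parityColouring : Coloring (S (suc (suc m)) k) (suc (suc (suc m)))
  parityColouring = colouring parityColour parityColour-proper

  colour-first : ∀ j → parityColour (just (j , first k≥1)) ≡ Fin.suc j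
  colour-first j rewrite toℕ-first k≥1 = refl

  on-leg : ∀ v j → parityColour v ≡ Fin.suc j → ∃ λ b → v ≡ just (j , b)
  on-leg (just (i , a)) j colour≡ with even (toℕ a)
  on-leg (just (i , a)) j refl | true = a , refl

  hub-class : ∀ j → ClassDist parityColouring nothing (Fin.suc j) 1
  hub-class j = (just (j , first k≥1) , colour-first j , cong suc (toℕ-first k≥1)) , λ v colour≡ →
    case-on-leg v (on-leg v j colour≡)
    where
    case-on-leg : ∀ v → ∃ (λ b → v ≡ just (j , b)) → 1 ≤ dist nothing v
    case-on-leg _ (_ , refl) = s≤s z≤n

  far-class : ∀ {i j} (a : Fin k) → i ≢ j → ClassDist parityColouring (just (i , a)) (Fin.suc j) (suc (suc (toℕ a)))
  far-class {i} {j} a i≢j = (just (j , first k≥1) , colour-first j , via-hub) , λ v colour≡ → lower v (on-leg v j colour≡)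
    where
    via-hub : dist (just (i , a)) (just (j , first k≥1)) ≡ suc (suc (toℕ a))
    via-hub with i Fin.≟ j
    ... | yes i≡j = ⊥-elim (i≢j i≡j)
    ... | no _ rewrite toℕ-first k≥1 = cong suc (+-comm (toℕ a) 1)
    lower : ∀ v → ∃ (λ b → v ≡ just (j , b)) → suc (suc (toℕ a)) ≤ dist (just (i , a)) v
    lower _ (b , refl) with i Fin.≟ j
    ... | yes i≡j = ⊥-elim (i≢j i≡j)
    ... | no _ = s≤s (≤-trans (≤-reflexive (+-comm 1 (toℕ a))) (+-monoʳ-≤ (toℕ a) (s≤s z≤n)))

  near-class : ∀ i (a : Fin k) → ∃ λ d → d ≤ 1 × ClassDist parityColouring (just (i , a)) (Fin.suc i) d
  near-class i a with even (toℕ a) in parity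
  ... | true = 0 , z≤n ,
               subst (λ x → ClassDist parityColouring (just (i , a)) x 0) colour≡ (ClassDist-own parityColouring _)
    where
    colour≡ : parityColour (just (i , a)) ≡ Fin.suc i
    colour≡ rewrite parity = refl
  ... | false with toℕ a in a≡
  ...   | zero = contradiction parity λ ()
  ...   | suc p = 1 , ≤-refl , (just (i , above) , colour≡ , one-step) , λ v colour≡v →
                        ≢⇒0<dist (just (i , a)) v λ { refl → Finₚ.0≢1+n (trans (sym own-colour) colour≡v) }
    where
    p<k : p < k
    p<k = ≤-trans (≤-reflexive (sym a≡)) (≤-trans (n≤1+n _) (Finₚ.toℕ<n a))
    above : Fin k
    above = fromℕ< p<k
    colour≡ : parityColour (just (i , above)) ≡ Fin.suc i
    colour≡ rewrite Finₚ.toℕ-fromℕ< p<k with even p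
    ... | true = refl
    ... | false = contradiction parity λ ()
    own-colour : parityColour (just (i , a)) ≡ Fin.zero
    own-colour rewrite a≡ | parity = refl
    one-step : dist (just (i , a)) (just (i , above)) ≡ 1
    one-step with i Fin.≟ i
    ... | no i≢i = ⊥-elim (i≢i refl)
    ... | yes _ = trans (cong₂ ∣_-_∣ a≡ (Finₚ.toℕ-fromℕ< p<k)) (trans (∣-∣-comm (suc p) p) (∣n-1+n∣≡1 p))

  other : Fin (suc (suc m)) → Fin (suc (suc m))
  other Fin.zero = Fin.suc Fin.zero
  other (Fin.suc _) = Fin.zero

  ≢other : ∀ i → i ≢ other i
  ≢other Fin.zero ()
  ≢other (Fin.suc _) ()

  parityColour-locating : IsLocating (S (suc (suc m)) k) parityColouring
  parityColour-locating nothing nothing _ = refl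
  parityColour-locating nothing (just (i , a)) same =
    contradiction (SameCode⇒ClassDist≡ parityColouring same (hub-class (other i)) (far-class a (≢other i))) λ ()
  parityColour-locating (just u) nothing same =
    sym (parityColour-locating nothing (just u) (SameCode-sym parityColouring same))
  parityColour-locating (just (i , a)) (just (j , b)) same with i Fin.≟ j
  ... | yes refl = cong (λ c → just (i , c)) (Finₚ.toℕ-injective (suc-injective (suc-injective
        (SameCode⇒ClassDist≡ parityColouring same (far-class a (≢other i)) (far-class b (≢other i))))))
  ... | no i≢j with near-class i a
  ...   | d , d≤1 , D = contradiction
          (subst (_≤ 1) (SameCode⇒ClassDist≡ parityColouring same D (far-class b (i≢j ∘ sym))) d≤1)
          λ { (s≤s ()) }

spider-locating-colouring : ∀ m {k} → 1 ≤ k → HasLocatingColoring (S (suc (suc m)) k) (suc (suc (suc m)))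
spider-locating-colouring m {k} k≥1 = parityColouring , parityColour-locating
  where open ParityColouring m k k≥1

module LegRemoval (m k : ℕ) {b : ℕ} (c : Coloring (S (suc m) k) b) where
  module Big = Spider (suc m) k
  module Small = Spider m k
  open Coloring c

  -- A witness of Shadowed (the hub, or a vertex no deeper on another leg) is at least as close
  -- as the vertex (L , a) to every vertex off leg L.
  Shadowed : Fin (suc m) → Fin b → Fin k → Set
  Shadowed L x a = col (just (L , a)) ≡ x →
    col nothing ≡ x ⊎ ∃₂ λ L′ a′ → L′ ≢ L × toℕ a′ ≤ toℕ a × col (just (L′ , a′)) ≡ x

  shadowed? : ∀ L x a → Dec (Shadowed L x a)
  shadowed? L x a = (col (just (L , a)) Fin.≟ x) →-dec ((col nothing Fin.≟ x) ⊎-dec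
    (Finₚ.any? λ L′ → Finₚ.any? λ a′ →
       ¬? (L′ Fin.≟ L) ×-dec (toℕ a′ ≤? toℕ a) ×-dec (col (just (L′ , a′)) Fin.≟ x)))

  Removable : Fin (suc m) → Set
  Removable L = ∀ x a → Shadowed L x a

  removable? : Decidable Removable
  removable? L = Finₚ.all? λ x → Finₚ.all? (shadowed? L x)

  exposed : ∀ L → ¬ Removable L → ∃₂ λ x a → col (just (L , a)) ≡ x ×
            ∀ L′ a′ → L′ ≢ L → toℕ a′ ≤ toℕ a → col (just (L′ , a′)) ≢ x
  exposed L irremovable with Finₚ.¬∀⟶∃¬ b _ (λ x → Finₚ.all? (shadowed? L x)) irremovable
  ... | x , ¬shadowed with Finₚ.¬∀⟶∃¬ k _ (shadowed? L x) ¬shadowed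
  ...   | a , ¬shadowedAt with col (just (L , a)) Fin.≟ x
  ...     | no ≢x = contradiction (⊥-elim ∘ ≢x) ¬shadowedAt
  ...     | yes ≡x = x , a , ≡x , λ L′ a′ L′≢L a′≤a ≡x′ →
                       ¬shadowedAt λ _ → inj₂ (L′ , a′ , L′≢L , a′≤a , ≡x′)

  -- Two legs exposed in the same colour contradict each other at the shallower of the two witnesses.
  irremovable⇒legs≤colours : (∀ L → ¬ Removable L) → suc m ≤ b
  irremovable⇒legs≤colours irremovable = Finₚ.injective⇒≤ {f = colourOf} injective
    where
    colourOf : Fin (suc m) → Fin b
    colourOf L = proj₁ (exposed L (irremovable L))
    injective : ∀ {L L′} → colourOf L ≡ colourOf L′ → L ≡ L′
    injective {L} {L′} same with L Fin.≟ L′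
    ... | yes L≡L′ = L≡L′
    ... | no L≢L′ with exposed L (irremovable L) | exposed L′ (irremovable L′)
    ...   | x , a , ≡x , avoid | x′ , a′ , ≡x′ , avoid′ with ≤-total (toℕ a′) (toℕ a)
    ...     | inj₁ a′≤a = ⊥-elim (avoid L′ a′ (L≢L′ ∘ sym) a′≤a (trans ≡x′ (sym same)))
    ...     | inj₂ a≤a′ = ⊥-elim (avoid′ L a L≢L′ a≤a′ (trans ≡x same))

  module Remove (L : Fin (suc m)) where

    ι : Small.Vertex → Big.Vertex
    ι nothing = nothing
    ι (just (i , a)) = just (punchIn L i , a)

    ι-injective : ∀ u v → ι u ≡ ι v → u ≡ v
    ι-injective nothing nothing _ = refl
    ι-injective (just (i , a)) (just (j , b)) ιu≡ιv with Maybeₚ.just-injective ιu≡ιv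
    ... | same rewrite Finₚ.punchIn-injective L i j (cong proj₁ same) | cong proj₂ same = refl

    ι-adj : ∀ {u v} → SAdj m k u v → SAdj (suc m) k (ι u) (ι v)
    ι-adj (hub-out e) = hub-out e
    ι-adj (hub-in e) = hub-in e
    ι-adj (step-up e) = step-up e
    ι-adj (step-dn e) = step-dn e

    dist-ι : ∀ u v → Big.dist (ι u) (ι v) ≡ Small.dist u v
    dist-ι nothing nothing = refl
    dist-ι nothing (just _) = refl
    dist-ι (just _) nothing = refl
    dist-ι (just (i , a)) (just (j , b)) with punchIn L i Fin.≟ punchIn L j | i Fin.≟ j
    ... | yes _ | yes _ = refl
    ... | no _ | no _ = refl
    ... | yes ≡ | no ≢ = ⊥-elim (≢ (Finₚ.punchIn-injective L i j ≡))
    ... | no ≢ | yes ≡ = ⊥-elim (≢ (cong (punchIn L) ≡))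

    dist-ι-L : ∀ u (a : Fin k) → Big.dist (ι u) (just (L , a)) ≡ Small.depth u + suc (toℕ a)
    dist-ι-L nothing a = refl
    dist-ι-L (just (i , _)) a with punchIn L i Fin.≟ L
    ... | yes ≡L = ⊥-elim (Finₚ.punchInᵢ≢i L i ≡L)
    ... | no _ = refl

    off-L : ∀ {i} → i ≢ L → ∃ λ j → punchIn L j ≡ i
    off-L i≢L = punchOut (i≢L ∘ sym) , Finₚ.punchIn-punchOut (i≢L ∘ sym)

    restricted : Coloring (S m k) b
    restricted = record { col = col ∘ ι ; proper = proper ∘ ι-adj }

    module _ (removable : Removable L) where

      shadow : ∀ {x} w → col w ≡ x → ∃ λ v → col (ι v) ≡ x × ∀ u → Small.dist u v ≤ Big.dist (ι u) w
      shadow nothing cw = nothing , cw , λ u → ≤-reflexive (sym (dist-ι u nothing))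
      shadow (just (i , a)) cw with i Fin.≟ L
      ... | no i≢L with off-L i≢L
      ...   | j , refl = just (j , a) , cw , λ u → ≤-reflexive (sym (dist-ι u (just (j , a))))
      shadow {x} (just (i , a)) cw | yes refl with removable x a cw
      ... | inj₁ hub≡x = nothing , hub≡x , λ u →
            ≤-trans (m≤m+n (Small.depth u) _) (≤-reflexive (sym (dist-ι-L u a)))
      ... | inj₂ (L′ , a′ , L′≢L , a′≤a , ≡x) with off-L L′≢L
      ...   | j , refl = just (j , a′) , ≡x , λ u → begin
              Small.dist u (just (j , a′))      ≤⟨ Small.dist-via-hub u j a′ ⟩
              Small.depth u + suc (toℕ a′)      ≤⟨ +-monoʳ-≤ (Small.depth u) (s≤s a′≤a) ⟩
              Small.depth u + suc (toℕ a)       ≡⟨ dist-ι-L u a ⟨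
              Big.dist (ι u) (just (L , a))     ∎
        where open ≤-Reasoning

      ClassDist-ι : ∀ {u x d} → Small.ClassDist restricted u x d → Big.ClassDist c (ι u) x d
      ClassDist-ι {u} ((v , cv , duv) , least) = (ι v , cv , trans (dist-ι u v) duv) , λ w cw →
        let (v′ , cv′ , closer) = shadow w cw in ≤-trans (least v′ cv′) (closer u)

      ClassDist-ι⁻ : ∀ {u x d} → Big.ClassDist c (ι u) x d → Small.ClassDist restricted u x d
      ClassDist-ι⁻ {u} {d = d} ((w , cw , dw) , least) with shadow w cw
      ... | v , cv , closer = (v , cv , ≤-antisym (≤-trans (closer u) (≤-reflexive dw)) (least-ι v cv)) , least-ι
        where
        least-ι : ∀ v → col (ι v) ≡ _ → d ≤ Small.dist u v
        least-ι v cv = subst (d ≤_) (dist-ι u v) (least (ι v) cv)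

      restricted-locating : IsLocating (S (suc m) k) c → IsLocating (S m k) restricted
      restricted-locating loc u v same = ι-injective u v (loc (ι u) (ι v) λ x d → mk⇔
        (transfer same) (transfer (Small.SameCode-sym restricted same)))
        where
        transfer : ∀ {u v x d} → SameCode (S m k) restricted u v →
                   DistToClass (S (suc m) k) c (ι u) x d → DistToClass (S (suc m) k) c (ι v) x d
        transfer {u} {v} same = Big.ClassDist⇒DistToClass c {ι v} ∘ ClassDist-ι {v} ∘
          Small.SameCode⇒ClassDist restricted same ∘ ClassDist-ι⁻ {u} ∘ Big.DistToClass⇒ClassDist c {ι u}

  χL≤colours : IsLocating (S (suc m) k) c → HasLocatingColoring (S m k) (suc m) →
               ∀ {a} → IsLocChromNum (S m k) a → a ≤ b
  χL≤colours loc small-colouring χa with Finₚ.any? removable?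
  ... | yes (L , removable) = IsLocChromNum⇒≤ χa (Remove.restricted L , Remove.restricted-locating L removable loc)
  ... | no irremovable = ≤-trans (IsLocChromNum⇒≤ χa small-colouring)
                                 (irremovable⇒legs≤colours λ L removable → irremovable (L , removable))

χL-monotone : ∀ m {k a b} → 1 ≤ k →
              IsLocChromNum (S (suc (suc m)) k) a → IsLocChromNum (S (suc (suc (suc m))) k) b → a ≤ b
χL-monotone m {k} k≥1 χa ((c , loc) , _) =
  LegRemoval.χL≤colours (suc (suc m)) k c loc (spider-locating-colouring m k≥1) χa

χL-unbounded : ∀ {k} → 1 ≤ k → ∀ m → Σ ℕ λ n → 3 ≤ n × Σ ℕ λ b → IsLocChromNum (S n k) b × m ≤ b
χL-unbounded {k} k≥1 m with Spider.χL-exists (3 + 3 ^ m) k (spider-locating-colouring (suc (3 ^ m)) k≥1)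
... | χ , χ-locating@((c , loc) , _) = 3 + 3 ^ m , s≤s (s≤s (s≤s z≤n)) , χ , χ-locating , ≮⇒≥ λ χ<m →
  <-irrefl refl (begin-strict
    3 ^ m          <⟨ m<n+m (3 ^ m) (s≤s z≤n) ⟩
    3 + 3 ^ m      ≤⟨ Spider.legs≤3^colours (3 + 3 ^ m) k k≥1 c loc ⟩
    3 ^ χ          ≤⟨ ^-monoʳ-≤ 3 (<⇒≤ χ<m) ⟩
    3 ^ m          ∎)
  where open ≤-Reasoning

lemma3 : (k : ℕ) → 1 ≤ k →
    ((n : ℕ) → 3 ≤ n → (a b : ℕ) →
       IsLocChromNum (S (n ∸ 1) k) a → IsLocChromNum (S n k) b → a ≤ b)
    × ((m : ℕ) → Σ ℕ λ n → 3 ≤ n × Σ ℕ λ b → IsLocChromNum (S n k) b × m ≤ b)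
lemma3 k k≥1 = monotone , χL-unbounded k≥1
  where
  monotone : (n : ℕ) → 3 ≤ n → (a b : ℕ) → IsLocChromNum (S (n ∸ 1) k) a → IsLocChromNum (S n k) b → a ≤ b
  monotone (suc (suc (suc m))) (s≤s (s≤s (s≤s _))) a b = χL-monotone m k≥1
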